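{- Let $k \geq 2$ be an integer. Suppose that every admissible set of size $k$ contains a weak Polignac number in its difference set. Then \[ \liminf_{x \rightarrow \infty}\frac{\mathcal{P}(x)}{x} \geq \frac{2}{(k - 1)\bigl((k - 1)(k - 2) + 2\bigr)P(k)}, \] where $P(k) = \prod_{p \leq k} p$ is the product of all primes $p \leq k$.
   Context: A finite set of integers $\mathcal{H} = \{h_1, \ldots, h_k\}$ (with $k$ distinct elements, "of size $k$") is called admissible if for every prime $p$ there exists an integer $m$ such that $h_i \not\equiv m \pmod{p}$ for all $1 \leq i \leq k$. Its difference set is $\mathcal{D} = \{h_j - h_i : h_i < h_j\}$. A positive integer $d$ is a weak Polignac number if there are infinitely many pairs of primes $(p, q)$ with $q - p = d$. For real $x$, $\mathcal{P}(x)$ denotes the number of weak Polignac numbers less than or equal to $x$. -}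

module Defs where

open import Data.Nat as ℕ using (ℕ; zero; suc; _+_; _*_; _∸_; _≤_; NonZero)
open import Data.Nat.Properties using (m*n≢0; +-comm)
open import Data.Nat.Primality using (Prime; prime?)
open import Data.Integer as ℤ using (ℤ; +_; _-_; _<_)
open import Data.Integer.Divisibility using (_∣_)
open import Data.Rational as ℚ using (ℚ; _/_)
open import Data.Fin using (Fin)
open import Data.Vec using (Vec; lookup)
open import Data.List using (List; length)
open import Data.List.Relation.Unary.All using (All)
open import Data.List.Relation.Unary.Unique.Propositional using (Unique)
open import Data.Product using (Σ; ∃; _×_; _,_)
open import Relation.Binary.PropositionalEquality using (_≡_; refl)
open import Relation.Nullary using (¬_; yes; no)

-- A set of k integers, given as a vector with pairwise distinct entries.
Distinct : {k : ℕ} → Vec ℤ k → Set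
Distinct {k} h = (i j : Fin k) → lookup h i ≡ lookup h j → i ≡ j

Admissible : {k : ℕ} → Vec ℤ k → Set
Admissible {k} h = (p : ℕ) → Prime p → ∃ λ (m : ℤ) → (i : Fin k) → ¬ ((+ p) ∣ (lookup h i - m))

InDifferenceSet : {k : ℕ} → Vec ℤ k → ℕ → Set
InDifferenceSet {k} h d = Σ (Fin k) λ i → Σ (Fin k) λ j → (lookup h i < lookup h j) × (lookup h j - lookup h i ≡ + d)

-- d is a weak Polignac number: d ≥ 1 and there are infinitely many prime pairs (p, p + d).
WeakPolignac : ℕ → Set
WeakPolignac d = (1 ≤ d) × ((N : ℕ) → ∃ λ p → (N ≤ p) × Prime p × Prime (p + d))

-- "𝒫(n) ≥ m": there are at least m distinct weak Polignac numbers ≤ n.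
AtLeastWeakPolignacUpTo : ℕ → ℕ → Set
AtLeastWeakPolignacUpTo n m =
  ∃ λ (ds : List ℕ) → Unique ds × All (λ d → WeakPolignac d × d ≤ n) ds × length ds ≡ m

primorial : ℕ → ℕ
primorial zero = 1
primorial (suc n) with prime? (suc n)
... | yes _ = suc n * primorial n
... | no  _ = primorial n

primorial-nonZero : ∀ n → NonZero (primorial n)
primorial-nonZero zero = _
primorial-nonZero (suc n) with prime? (suc n)
... | yes _ = m*n≢0 (suc n) (primorial n) {{_}} {{primorial-nonZero n}}
... | no  _ = primorial-nonZero n

denom : ℕ → ℕ
denom k = (k ∸ 1) * ((k ∸ 1) * (k ∸ 2) + 2) * primorial k

≡-nonZero : ∀ {a b} → a ≡ suc b → NonZero a
≡-nonZero refl = _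

denom-nonZero : ∀ k → 2 ≤ k → NonZero (denom k)
denom-nonZero (suc (suc j)) _ =
  m*n≢0 (suc j * (suc j * j + 2)) (primorial (suc (suc j)))
    {{m*n≢0 (suc j) (suc j * j + 2) {{_}} {{≡-nonZero (+-comm (suc j * j) 2)}}}}
    {{primorial-nonZero (suc (suc j))}}
denom-nonZero (suc zero) (ℕ.s≤s ())

bound : (k : ℕ) → 2 ≤ k → ℚ
bound k hk = (+ 2 / denom k) {{denom-nonZero k hk}}

module Submission where

open import Defs
open import Data.Nat using (ℕ; zero; suc; s≤s; _≤_)
open import Data.Vec using (Vec)
open import Data.Integer using (ℤ; +_)
open import Data.Product using (∃; _×_; _,_)

-- Write k = K + 1 with K ≥ 1 and P = P(k).  If P ∣ c then the
-- arithmetic progression 0, c, 2c, …, (k - 1)c is admissible: a prime p ∣ c misses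
-- the class 1, and a prime p ∤ c misses a class because p ≤ k would force p ∣ P ∣ c.
-- Its differences are the multiples c·e with 1 ≤ e ≤ K, so the hypothesis yields a
-- weak Polignac number f(u) = c_u · e_u for every c_u = P(1 + K u), u ∈ ℕ.
-- Reducing modulo K shows that u ↦ f(u) is injective, and f(u) ≤ (u + 1)·Q with
-- Q = P K².  Hence 𝒫(x) ≥ ⌊x / Q⌋ =: m, and since x < (m + 1) Q and
-- 2Q ≤ (k - 1)((k - 1)(k - 2) + 2) P(k) we get 2/denom - 1/x ≤ m/x, which is the
-- liminf bound once 1/x ≤ ε.

module RationalBounds where

  open import Data.Nat as ℕ using (zero; NonZero)
  import Data.Nat.Properties as ℕP
  open import Data.Integer as ℤ using (+[1+_]; -[1+_])
  import Data.Integer.Properties as ℤP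
  open import Data.Integer.Tactic.RingSolver using (solve-∀)
  open import Data.Rational as ℚ using (ℚ; 0ℚ; mkℚ; _/_; _-_; _+_; -_; _<_; toℚᵘ; positive)
  import Data.Rational.Properties as ℚP
  open import Data.Rational.Unnormalised as ℚᵘ using (mkℚᵘ; *≤*; *≡*)
  import Data.Rational.Unnormalised.Properties as ℚᵘP
  open import Data.Empty using (⊥-elim-irr)
  open import Data.Product using (Σ; _,_)
  open import Relation.Binary.PropositionalEquality

  toℚᵘ-/ : ∀ i d → toℚᵘ (i / suc d) ℚᵘ.≃ mkℚᵘ i d
  toℚᵘ-/ i d = ℚP.toℚᵘ-fromℚᵘ (mkℚᵘ i d)

  fraction-≤ : ∀ a b c d → a ℕ.* suc d ℕ.≤ c ℕ.* suc b → + a / suc b ℚ.≤ + c / suc d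
  fraction-≤ a b c d ad≤cb =
    ℚP.toℚᵘ-cancel-≤
      (ℚᵘP.≤-respˡ-≃ (ℚᵘP.≃-sym (toℚᵘ-/ (+ a) b))
        (ℚᵘP.≤-respʳ-≃ (ℚᵘP.≃-sym (toℚᵘ-/ (+ c) d))
          (*≤* (subst₂ ℤ._≤_ (ℤP.pos-* a (suc d)) (ℤP.pos-* c (suc b)) (ℤ.+≤+ ad≤cb)))))

  fraction-suc : ∀ a n → + suc a / suc n ≡ (+ a / suc n) + (+ 1 / suc n)
  fraction-suc a n = ℚP.toℚᵘ-injective (begin-equality
    toℚᵘ (+ suc a / suc n)                          ≃⟨ toℚᵘ-/ (+ suc a) n ⟩
    mkℚᵘ (+ suc a) n                                ≃⟨ *≡* (cross-multiplied a n) ⟩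
    mkℚᵘ (+ a) n ℚᵘ.+ mkℚᵘ (+ 1) n                  ≃⟨ ℚᵘP.+-cong (toℚᵘ-/ (+ a) n) (toℚᵘ-/ (+ 1) n) ⟨
    toℚᵘ (+ a / suc n) ℚᵘ.+ toℚᵘ (+ 1 / suc n)      ≃⟨ ℚP.toℚᵘ-homo-+ (+ a / suc n) (+ 1 / suc n) ⟨
    toℚᵘ ((+ a / suc n) + (+ 1 / suc n))            ∎)
    where
    open ℚᵘP.≤-Reasoning
    identity : ∀ x y → (+ 1 ℤ.+ x) ℤ.* (y ℤ.* y) ≡ (x ℤ.* y ℤ.+ + 1 ℤ.* y) ℤ.* y
    identity = solve-∀
    cross-multiplied : ∀ a n → + suc a ℤ.* (+ suc n ℤ.* + suc n)
                              ≡ (+ a ℤ.* + suc n ℤ.+ + 1 ℤ.* + suc n) ℤ.* + suc n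
    cross-multiplied a n rewrite ℤP.pos-+ 1 a = identity (+ a) (+ suc n)

  ≤-+⇒-≤ : ∀ x y e → x ℚ.≤ y + e → x - e ℚ.≤ y
  ≤-+⇒-≤ x y e x≤y+e = ℚP.≤-trans (ℚP.+-monoˡ-≤ (- e) x≤y+e) (ℚP.≤-reflexive cancel)
    where
    open ≡-Reasoning
    cancel : (y + e) - e ≡ y
    cancel = begin
      (y + e) - e   ≡⟨ ℚP.+-assoc y e (- e) ⟩
      y + (e - e)   ≡⟨ cong (λ z → y + z) (ℚP.+-inverseʳ e) ⟩
      y + 0ℚ        ≡⟨ ℚP.+-identityʳ y ⟩
      y             ∎

  archimedean : (ε : ℚ) → 0ℚ < ε → Σ ℕ λ N → ∀ n → N ℕ.≤ n → + 1 / suc n ℚ.≤ ε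
  archimedean ε@(mkℚ +[1+ a ] d _) _ = d , λ n d≤n →
    subst (+ 1 / suc n ℚ.≤_) (ℚP.↥p/↧p≡p ε)
      (fraction-≤ 1 n (suc a) d
        (ℕP.≤-trans (ℕP.≤-reflexive (ℕP.*-identityˡ (suc d)))
          (ℕP.≤-trans (ℕ.s≤s d≤n) (ℕP.m≤n*m (suc n) (suc a)))))
  archimedean (mkℚ (+ zero) _ _) 0<ε with positive 0<ε
  ... | ()
  archimedean (mkℚ -[1+ _ ] _ _) 0<ε with positive 0<ε
  ... | ()

  -- The final estimate: if 2(n + 1) ≤ (m + 1) B and 1/(n + 1) ≤ ε then
  -- 2/B - ε ≤ m/(n + 1), because 2/B ≤ (m + 1)/(n + 1) = m/(n + 1) + 1/(n + 1).
  density-estimate : (m n B : ℕ) .{{_ : NonZero B}} (ε : ℚ) →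
    2 ℕ.* suc n ℕ.≤ suc m ℕ.* B → + 1 / suc n ℚ.≤ ε → (+ 2 / B) - ε ℚ.≤ + m / suc n
  density-estimate m n zero {{B≢0}} ε _ _ = ⊥-elim-irr (NonZero.nonZero B≢0)
  density-estimate m n (suc B) ε 2x≤[m+1]B 1/x≤ε = ≤-+⇒-≤ (+ 2 / suc B) (+ m / suc n) ε
    (ℚP.≤-trans (fraction-≤ 2 B (suc m) n 2x≤[m+1]B)
      (ℚP.≤-trans (ℚP.≤-reflexive (fraction-suc m n)) (ℚP.+-monoʳ-≤ (+ m / suc n) 1/x≤ε)))

module Progressions where

  open import Data.Nat as ℕ using (zero; NonZero; _*_; _+_; _∸_; _<_; s≤s; >-nonZero)
  open import Data.Nat.Properties
  open import Data.Nat.Divisibility using (_∣_; _∣?_; ∣-trans; ∣⇒≤; ∣1⇒≡1; ∣m+n∣m⇒∣n; m∣m*n; n∣m*n)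
  open import Data.Nat.Primality using (Prime; prime?; ¬prime[0]; ¬prime[1]; euclidsLemma)
  open import Data.Integer as ℤ using ()
  import Data.Integer.Properties as ℤP
  open import Data.Fin using (Fin; toℕ)
  open import Data.Fin.Properties using (toℕ-injective; toℕ<n)
  open import Data.Vec using (lookup; tabulate)
  open import Data.Vec.Properties using (lookup∘tabulate)
  open import Data.Product using (Σ; _,_)
  open import Data.Sum using (inj₁; inj₂)
  open import Data.Empty using (⊥-elim)
  open import Relation.Nullary using (yes; no)
  open import Relation.Binary.PropositionalEquality

  prime∣primorial : ∀ k p → Prime p → p ≤ k → p ∣ primorial k
  prime∣primorial zero p p-prime p≤0 with n≤0⇒n≡0 p≤0
  ... | refl = ⊥-elim (¬prime[0] p-prime)
  prime∣primorial (suc n) p p-prime p≤1+n with prime? (suc n) | m≤n⇒m<n∨m≡n p≤1+n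
  ... | yes _       | inj₂ refl = m∣m*n (primorial n)
  ... | no  ¬prime  | inj₂ refl = ⊥-elim (¬prime p-prime)
  ... | yes _       | inj₁ p<1+n = ∣-trans (prime∣primorial n p p-prime (≤-pred p<1+n)) (n∣m*n (suc n))
  ... | no  _       | inj₁ p<1+n = prime∣primorial n p p-prime (≤-pred p<1+n)

  progression : (k c : ℕ) → Vec ℤ k
  progression k c = tabulate (λ i → + (c * toℕ i))

  lookup-progression : ∀ k c (i : Fin k) → lookup (progression k c) i ≡ + (c * toℕ i)
  lookup-progression k c i = lookup∘tabulate (λ i → + (c * toℕ i)) i

  progression-distinct : ∀ k c .{{_ : NonZero c}} → Distinct (progression k c)
  progression-distinct k c i j same =
    toℕ-injective (*-cancelˡ-≡ (toℕ i) (toℕ j) c (ℤP.+-injective (begin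
      + (c * toℕ i)               ≡⟨ lookup-progression k c i ⟨
      lookup (progression k c) i  ≡⟨ same ⟩
      lookup (progression k c) j  ≡⟨ lookup-progression k c j ⟩
      + (c * toℕ j)               ∎)))
    where open ≡-Reasoning

  distance-to-shift : ∀ c i k r → i ≤ k →
    ℤ.∣ + (c * i) ℤ.- + (c * k + r) ∣ ≡ c * (k ∸ i) + r
  distance-to-shift c i k r i≤k = begin
    ℤ.∣ + (c * i) ℤ.- + (c * k + r) ∣  ≡⟨ cong ℤ.∣_∣ (ℤP.m-n≡m⊖n (c * i) (c * k + r)) ⟩
    ℤ.∣ c * i ℤ.⊖ (c * k + r) ∣        ≡⟨ ℤP.∣⊖∣-≤ ci≤ck+r ⟩
    (c * k + r) ∸ c * i                ≡⟨ cong (_∸ c * i) split ⟩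
    c * i + (c * (k ∸ i) + r) ∸ c * i  ≡⟨ m+n∸m≡n (c * i) _ ⟩
    c * (k ∸ i) + r                    ∎
    where
    open ≡-Reasoning
    split : c * k + r ≡ c * i + (c * (k ∸ i) + r)
    split = begin
      c * k + r                  ≡⟨ cong (λ z → c * z + r) (m+[n∸m]≡n i≤k) ⟨
      c * (i + (k ∸ i)) + r      ≡⟨ cong (_+ r) (*-distribˡ-+ c i (k ∸ i)) ⟩
      c * i + c * (k ∸ i) + r    ≡⟨ +-assoc (c * i) _ r ⟩
      c * i + (c * (k ∸ i) + r)  ∎
    ci≤ck+r : c * i ≤ c * k + r
    ci≤ck+r = ≤-trans (*-monoʳ-≤ c i≤k) (m≤m+n (c * k) r)

  progression-distance : ∀ k c r (i : Fin k) →
    ℤ.∣ lookup (progression k c) i ℤ.- + (c * k + r) ∣ ≡ c * (k ∸ toℕ i) + r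
  progression-distance k c r i =
    trans (cong (λ h → ℤ.∣ h ℤ.- + (c * k + r) ∣) (lookup-progression k c i))
          (distance-to-shift c (toℕ i) k r (<⇒≤ (toℕ<n i)))

  -- When P(k) ∣ c, a prime dividing c·(k - i) with i < k divides c: by Euclid's lemma
  -- it divides c or k - i, and in the latter case p ≤ k, so p ∣ P(k) ∣ c.
  prime∣c*[k-i]⇒prime∣c : ∀ k c → primorial k ∣ c → ∀ p → Prime p → (i : Fin k) →
    p ∣ c * (k ∸ toℕ i) → p ∣ c
  prime∣c*[k-i]⇒prime∣c k c P∣c p p-prime i p∣c[k-i] with euclidsLemma c (k ∸ toℕ i) p-prime p∣c[k-i]
  ... | inj₁ p∣c = p∣c
  ... | inj₂ p∣k-i = ∣-trans (prime∣primorial k p p-prime p≤k) P∣c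
    where
    0<k-i : 0 < k ∸ toℕ i
    0<k-i = m<n⇒0<n∸m (toℕ<n i)
    p≤k : p ≤ k
    p≤k = ≤-trans (∣⇒≤ {{>-nonZero 0<k-i}} p∣k-i) (m∸n≤m k (toℕ i))

  -- If P(k) ∣ c the progression is admissible: for a prime p the class of c·k + 1
  -- is missed when p ∣ c (the gaps are ≡ 1 mod p), and the class of c·k otherwise.
  progression-admissible : ∀ k c → primorial k ∣ c → Admissible (progression k c)
  progression-admissible k c P∣c p p-prime with p ∣? c
  ... | yes p∣c = + (c * k + 1) , λ i p∣gap →
    let p∣c[k-i]+1 = subst (p ∣_) (progression-distance k c 1 i) p∣gap
        p∣1 = ∣m+n∣m⇒∣n p∣c[k-i]+1 (∣-trans p∣c (m∣m*n (k ∸ toℕ i)))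
    in ¬prime[1] (subst Prime (∣1⇒≡1 p∣1) p-prime)
  ... | no p∤c = + (c * k + 0) , λ i p∣gap →
    let p∣c[k-i] = subst (p ∣_) (trans (progression-distance k c 0 i) (+-identityʳ _)) p∣gap
    in p∤c (prime∣c*[k-i]⇒prime∣c k c P∣c p p-prime i p∣c[k-i])

  progression-difference : ∀ k c d → InDifferenceSet (progression k c) d →
    Σ ℕ λ e → (0 < e) × (e < k) × (d ≡ c * e)
  progression-difference k c d (i , j , hᵢ<hⱼ , hⱼ-hᵢ≡d) =
    toℕ j ∸ toℕ i , m<n⇒0<n∸m i<j , ≤-trans (s≤s (m∸n≤m (toℕ j) (toℕ i))) (toℕ<n j) ,
    (begin
      d                        ≡⟨ ℤP.+-injective c[j-i]≡d ⟨
      c * toℕ j ∸ c * toℕ i    ≡⟨ *-distribˡ-∸ c (toℕ j) (toℕ i) ⟨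
      c * (toℕ j ∸ toℕ i)      ∎)
    where
    open ≡-Reasoning
    ci<cj : c * toℕ i < c * toℕ j
    ci<cj = ℤP.drop‿+<+ (subst₂ ℤ._<_ (lookup-progression k c i) (lookup-progression k c j) hᵢ<hⱼ)
    i<j : toℕ i < toℕ j
    i<j = *-cancelˡ-< c (toℕ i) (toℕ j) ci<cj
    c[j-i]≡d : + (c * toℕ j ∸ c * toℕ i) ≡ + d
    c[j-i]≡d = begin
      + (c * toℕ j ∸ c * toℕ i)      ≡⟨ ℤP.⊖-≥ (<⇒≤ ci<cj) ⟨
      c * toℕ j ℤ.⊖ c * toℕ i        ≡⟨ ℤP.m-n≡m⊖n (c * toℕ j) (c * toℕ i) ⟨
      + (c * toℕ j) ℤ.- + (c * toℕ i) ≡⟨ subst₂ (λ a b → b ℤ.- a ≡ + d)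
                                          (lookup-progression k c i) (lookup-progression k c j) hⱼ-hᵢ≡d ⟩
      + d                            ∎

module PolignacFamily where

  open import Data.Nat as ℕ using (zero; NonZero; _*_; _+_; _∸_; _<_; z≤n; >-nonZero; >-nonZero⁻¹)
  open import Data.Nat.Properties
  open import Data.Nat.Divisibility using (_∣_; m∣m*n)
  open import Data.Nat.DivMod using (_%_; _/_; [m+kn]%n≡m%n; n%n≡0; m<n⇒m%n≡m; m/n*n≤m; m%n<n; m≡m%n+[m/n]*n)
  open import Data.Nat.Tactic.RingSolver using (solve-∀)
  open import Data.List using (applyUpTo)
  open import Data.List.Properties using (length-applyUpTo)
  import Data.List.Relation.Unary.All.Properties as AllP
  import Data.List.Relation.Unary.Unique.Propositional.Properties as UniqueP
  open import Data.Product using (Σ; _,_; proj₁; proj₂)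
  open import Data.Sum using (inj₁; inj₂)
  open import Data.Empty using (⊥-elim)
  open import Relation.Nullary using (¬_)
  open import Relation.Binary.PropositionalEquality
  open Progressions

  DifferenceHypothesis : ℕ → Set
  DifferenceHypothesis k =
    (h : Vec ℤ k) → Distinct h → Admissible h → ∃ λ d → InDifferenceSet h d × WeakPolignac d

  polignac-multiple : ∀ k → DifferenceHypothesis k → ∀ c .{{_ : NonZero c}} → primorial k ∣ c →
    Σ ℕ λ e → (0 < e) × (e < k) × WeakPolignac (c * e)
  polignac-multiple k hyp c P∣c
    with hyp (progression k c) (progression-distinct k c) (progression-admissible k c P∣c)
  ... | d , d∈D , d-polignac with progression-difference k c d d∈D
  ... | e , 0<e , e<k , d≡ce = e , 0<e , e<k , subst WeakPolignac d≡ce d-polignac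

  count-values : ∀ x m (f : ℕ → ℕ) → (∀ {u v} → f u ≡ f v → u ≡ v) →
    (∀ {u} → u < m → WeakPolignac (f u) × f u ≤ x) → AtLeastWeakPolignacUpTo x m
  count-values x m f f-injective f-bounded =
    applyUpTo f m ,
    UniqueP.applyUpTo⁺₁ f m (λ u<v _ fu≡fv → <⇒≢ u<v (f-injective fu≡fv)) ,
    AllP.applyUpTo⁺₁ f m f-bounded ,
    length-applyUpTo f m

  %-nonzero : ∀ K .{{_ : NonZero K}} {e} → 0 < e → e < K → ¬ (e % K ≡ 0)
  %-nonzero K 0<e e<K e%K≡0 = <⇒≢ 0<e (sym (trans (sym (m<n⇒m%n≡m e<K)) e%K≡0))

  residue-injective : ∀ K .{{_ : NonZero K}} {e e'} → 0 < e → e ≤ K → 0 < e' → e' ≤ K →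
    e % K ≡ e' % K → e ≡ e'
  residue-injective K 0<e e≤K 0<e' e'≤K same with m≤n⇒m<n∨m≡n e≤K | m≤n⇒m<n∨m≡n e'≤K
  ... | inj₁ e<K  | inj₁ e'<K = trans (sym (m<n⇒m%n≡m e<K)) (trans same (m<n⇒m%n≡m e'<K))
  ... | inj₁ e<K  | inj₂ refl = ⊥-elim (%-nonzero K 0<e e<K (trans same (n%n≡0 K)))
  ... | inj₂ refl | inj₁ e'<K = ⊥-elim (%-nonzero K 0<e' e'<K (trans (sym same) (n%n≡0 K)))
  ... | inj₂ refl | inj₂ refl = refl

  [1+Ku]*e%K : ∀ K .{{_ : NonZero K}} u e → (suc (K * u) * e) % K ≡ e % K
  [1+Ku]*e%K K u e = trans (cong (_% K) (expand K u e)) ([m+kn]%n≡m%n e (u * e) K)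
    where
    expand : ∀ K u e → suc (K * u) * e ≡ e + u * e * K
    expand = solve-∀

  [1+Ku]*e-injective : ∀ K .{{_ : NonZero K}} {u u' e e'} → 0 < e → e ≤ K → 0 < e' → e' ≤ K →
    suc (K * u) * e ≡ suc (K * u') * e' → u ≡ u'
  [1+Ku]*e-injective K {u} {u'} {e} {e'} 0<e e≤K 0<e' e'≤K same
    with residue-injective K 0<e e≤K 0<e' e'≤K
           (trans (sym ([1+Ku]*e%K K u e)) (trans (cong (_% K) same) ([1+Ku]*e%K K u' e')))
  ... | refl = *-cancelˡ-≡ u u' K (suc-injective (*-cancelʳ-≡ _ _ e {{>-nonZero 0<e}} same))

  n≤n*n : ∀ n → n ≤ n * n
  n≤n*n zero    = z≤n
  n≤n*n (suc n) = m≤m*n (suc n) (suc n)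

  -- 2K ≤ K(K - 1) + 2, i.e. (K - 1)(K - 2) ≥ 0 on the naturals.
  2K≤K[K-1]+2 : ∀ K → 2 * K ≤ K * (K ∸ 1) + 2
  2K≤K[K-1]+2 zero    = z≤n
  2K≤K[K-1]+2 (suc j) = begin
    2 * suc j          ≡⟨ expand j ⟩
    suc j + j + 1      ≤⟨ +-monoˡ-≤ 1 (+-monoʳ-≤ (suc j) (n≤n*n j)) ⟩
    suc j + j * j + 1  ≡⟨ collect j ⟩
    suc j * j + 2      ∎
    where
    open ≤-Reasoning
    expand : ∀ j → 2 * suc j ≡ suc j + j + 1
    expand = solve-∀
    collect : ∀ j → suc j + j * j + 1 ≡ suc j * j + 2
    collect = solve-∀

  2PK²≤denom : ∀ K → 2 * (primorial (suc K) * K * K) ≤ denom (suc K)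
  2PK²≤denom K = begin
    2 * (P * K * K)              ≡⟨ rearrange P K ⟩
    K * (2 * K) * P              ≤⟨ *-monoˡ-≤ P (*-monoʳ-≤ K (2K≤K[K-1]+2 K)) ⟩
    K * (K * (K ∸ 1) + 2) * P    ∎
    where
    open ≤-Reasoning
    P = primorial (suc K)
    rearrange : ∀ P K → 2 * (P * K * K) ≡ K * (2 * K) * P
    rearrange = solve-∀

  x<[1+x/Q]*Q : ∀ x Q .{{_ : NonZero Q}} → x < suc (x / Q) * Q
  x<[1+x/Q]*Q x Q = subst (_< suc (x / Q) * Q) (sym (m≡m%n+[m/n]*n x Q))
                          (+-monoˡ-< ((x / Q) * Q) (m%n<n x Q))

  module Family (K : ℕ) .{{_ : NonZero K}} (hyp : DifferenceHypothesis (suc K)) where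

    P : ℕ
    P = primorial (suc K)

    instance
      P≢0 : NonZero P
      P≢0 = primorial-nonZero (suc K)

    step : ℕ → ℕ
    step u = P * suc (K * u)

    witness : ∀ u → Σ ℕ λ e → (0 < e) × (e < suc K) × WeakPolignac (step u * e)
    witness u = polignac-multiple (suc K) hyp (step u) {{m*n≢0 P (suc (K * u))}} (m∣m*n _)

    multiplier : ℕ → ℕ
    multiplier u = proj₁ (witness u)

    0<multiplier : ∀ u → 0 < multiplier u
    0<multiplier u = proj₁ (proj₂ (witness u))

    multiplier≤K : ∀ u → multiplier u ≤ K
    multiplier≤K u = ≤-pred (proj₁ (proj₂ (proj₂ (witness u))))

    f : ℕ → ℕ
    f u = step u * multiplier u

    f-polignac : ∀ u → WeakPolignac (f u)
    f-polignac u = proj₂ (proj₂ (proj₂ (witness u)))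

    f-injective : ∀ {u v} → f u ≡ f v → u ≡ v
    f-injective {u} {v} fu≡fv =
      [1+Ku]*e-injective K (0<multiplier u) (multiplier≤K u) (0<multiplier v) (multiplier≤K v)
        (*-cancelˡ-≡ _ _ P (begin
          P * (suc (K * u) * multiplier u)   ≡⟨ *-assoc P _ (multiplier u) ⟨
          f u                                ≡⟨ fu≡fv ⟩
          f v                                ≡⟨ *-assoc P _ (multiplier v) ⟩
          P * (suc (K * v) * multiplier v)   ∎))
      where open ≡-Reasoning

    Q : ℕ
    Q = P * K * K

    instance
      Q≢0 : NonZero Q
      Q≢0 = m*n≢0 (P * K) K {{m*n≢0 P K}}

    f-bound : ∀ u → f u ≤ suc u * Q
    f-bound u = begin
      P * suc (K * u) * multiplier u   ≤⟨ *-monoʳ-≤ (step u) (multiplier≤K u) ⟩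
      P * suc (K * u) * K              ≤⟨ *-monoˡ-≤ K (*-monoʳ-≤ P 1+Ku≤K[1+u]) ⟩
      P * (K * suc u) * K              ≡⟨ rearrange P K u ⟩
      suc u * Q                        ∎
      where
      open ≤-Reasoning
      1+Ku≤K[1+u] : suc (K * u) ≤ K * suc u
      1+Ku≤K[1+u] = ≤-trans (+-monoˡ-≤ (K * u) (>-nonZero⁻¹ K)) (≤-reflexive (sym (*-suc K u)))
      rearrange : ∀ P K u → P * (K * suc u) * K ≡ suc u * (P * K * K)
      rearrange = solve-∀

    quota : ℕ → ℕ
    quota x = x / Q

    -- 𝒫(x) ≥ ⌊x / Q⌋: the values f(u), u < ⌊x / Q⌋, are at most x.
    count : ∀ x → AtLeastWeakPolignacUpTo x (quota x)
    count x = count-values x (quota x) f f-injective λ {u} u<m →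
      f-polignac u , ≤-trans (f-bound u) (≤-trans (*-monoˡ-≤ Q u<m) (m/n*n≤m x Q))

    2x≤[1+x/Q]*denom : ∀ x → 2 * x ≤ suc (quota x) * denom (suc K)
    2x≤[1+x/Q]*denom x = begin
      2 * x                          ≤⟨ *-monoʳ-≤ 2 (<⇒≤ (x<[1+x/Q]*Q x Q)) ⟩
      2 * (suc (x / Q) * Q)          ≡⟨ swap 2 (suc (x / Q)) Q ⟩
      suc (x / Q) * (2 * Q)          ≤⟨ *-monoʳ-≤ (suc (x / Q)) (2PK²≤denom K) ⟩
      suc (x / Q) * denom (suc K)    ∎
      where
      open ≤-Reasoning
      swap : ∀ a b c → a * (b * c) ≡ b * (a * c)
      swap = solve-∀

open RationalBounds
open PolignacFamily
-- The rational notation of the statement is opened only here: its _<_, _/_ and _-_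
-- would clash with the natural-number operations used in the modules above.
open import Data.Rational using (ℚ; 0ℚ; _/_; _-_; _<_)

theorem2 : (k : ℕ) → (hk : 2 ≤ k) →
    ((h : Vec ℤ k) → Distinct h → Admissible h → ∃ λ d → InDifferenceSet h d × WeakPolignac d) →
    (ε : ℚ) → 0ℚ < ε →
    ∃ λ N → (n : ℕ) → N ≤ n →
    ∃ λ m → AtLeastWeakPolignacUpTo (suc n) m × (bound k hk - ε) Data.Rational.≤ (+ m / suc n)
theorem2 k@(suc K@(suc _)) hk hyp ε 0<ε with archimedean ε 0<ε
... | N , 1/x≤ε = N , λ n N≤n →
  quota (suc n) , count (suc n) ,
  density-estimate (quota (suc n)) n (denom k) {{denom-nonZero k hk}} ε
    (2x≤[1+x/Q]*denom (suc n)) (1/x≤ε n N≤n)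
  where open Family K hyp
theorem2 (suc zero) (s≤s ())
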